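{- Let $n\ge1$ and $E_n=\wedge\{\alpha_1,\dots,\alpha_n,\theta_1,\dots,\theta_n\}$ over $\mathbb{C}$. Let $m\in\Phi(n)$ be a labelled matching containing arcs $\{i,k\}$ and $\{j,l\}$ with $i<j<k<l$. Let $m_0$ be obtained from $m$ by replacing these two arcs with arcs $\{i,j\}$ and $\{k,l\}$, and $m_1$ by replacing them with arcs $\{i,l\}$ and $\{j,k\}$ (all other arcs and labels unchanged). Then $F_m+F_{m_0}+F_{m_1}=0$ in $E_n$.
   Context: A matching of size $n$ is a collection of pairwise disjoint $2$-element subsets (arcs) of $\{1,\dots,n\}$; not every element need be matched. $\Phi(n)$ is the set of matchings of size $n$ in which each unmatched element is either labelled $\alpha$, labelled $\alpha\theta$, or unlabelled. For $m\in\Phi(n)$, $F_m\in E_n$ is defined as the product of $\alpha_i$ over unmatched vertices $i$ labelled $\alpha$ (taken in increasing order of $i$), times $\alpha_i\theta_i$ for each vertex $i$ labelled $\alpha\theta$, times $\alpha_i\theta_j+\alpha_j\theta_i$ for each arc $\{i,j\}$ of $m$ (the latter two kinds of factors have even degree and commute with everything). -}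

module Defs where

open import Level using (Level)
open import Algebra.Bundles using (CommutativeRing)
open import Data.Nat as ℕ using (ℕ; zero; suc)
open import Data.Bool using (Bool; true; false; not; if_then_else_)
open import Data.Fin as Fin using (Fin; toℕ; _<_)
open import Data.Fin.Properties using () renaming (_≟_ to _≟ᶠ_)
open import Data.List using (List; []; _∷_; _++_; map; concatMap; foldr; allFin)
open import Data.Bool.ListAction using (any)
open import Data.List.Properties using (≡-dec)
open import Data.List.Relation.Unary.Unique.Propositional using (Unique)
open import Data.List.Relation.Unary.All using (All)
open import Data.Maybe using (Maybe; just; nothing)
open import Data.Product using (_×_; _,_; proj₁; proj₂)
open import Relation.Nullary using (yes; no; does)
open import Relation.Binary.PropositionalEquality using (_≡_)

-- Generators of E_n : α_i and θ_i for i ∈ Fin n (vertex i+1 of the paper)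

data Gen (n : ℕ) : Set where
  α : Fin n → Gen n
  θ : Fin n → Gen n

-- an injective code into ℕ, used only to fix a reference order of the
-- generators (the standard basis of E_n = sorted monomials)
code : ∀ {n} → Gen n → ℕ
code (α i) = 2 ℕ.* toℕ i
code (θ i) = suc (2 ℕ.* toℕ i)

-- insert a code into a strictly increasing list; returns the new list and
-- the parity of the number of transpositions used, or nothing if the code
-- is already present (the monomial vanishes since x ∧ x = 0)
insert : ℕ → List ℕ → Maybe (List ℕ × Bool)
insert x [] = just (x ∷ [] , false)
insert x (y ∷ ys) with ℕ.compare x y
... | ℕ.less _ _ = just (x ∷ y ∷ ys , false)
... | ℕ.equal _ = nothing
... | ℕ.greater _ _ with insert x ys
...   | nothing = nothing
...   | just (zs , p) = just (y ∷ zs , not p)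

normalize : List ℕ → Maybe (List ℕ × Bool)
normalize [] = just ([] , false)
normalize (x ∷ xs) with normalize xs
... | nothing = nothing
... | just (ys , p) with insert x ys
...   | nothing = nothing
...   | just (zs , q) = just (zs , (if p then not q else q))

-- An element is a formal R-linear combination of words in the generators;
-- two elements are equal in E_n iff they have the same coefficient on every
-- standard basis monomial (strictly increasing list of generator codes).

module ExtAlg {c ℓ : Level} (R : CommutativeRing c ℓ) (n : ℕ) where
  open CommutativeRing R renaming (Carrier to K)

  E : Set c
  E = List (K × List (Gen n))

  zeroE : E
  zeroE = []

  oneE : E
  oneE = (1# , []) ∷ []

  gen : Gen n → E
  gen g = (1# , g ∷ []) ∷ []

  infixl 6 _⊕_
  infixl 7 _⊗_

  _⊕_ : E → E → E
  x ⊕ y = x ++ y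

  _⊗_ : E → E → E
  x ⊗ y = concatMap (λ t → map (λ s → (proj₁ t * proj₁ s , proj₂ t ++ proj₂ s)) y) x

  prodE : List E → E
  prodE = foldr _⊗_ oneE

  termCoeff : K × List (Gen n) → List ℕ → K
  termCoeff (r , w) S with normalize (map code w)
  ... | nothing = 0#
  ... | just (zs , p) with ≡-dec ℕ._≟_ zs S
  ...   | no _ = 0#
  ...   | yes _ = if p then - r else r

  coeff : E → List ℕ → K
  coeff [] S = 0#
  coeff (t ∷ x) S = termCoeff t S + coeff x S

  infix 4 _≋_
  _≋_ : E → E → Set ℓ
  x ≋ y = ∀ S → coeff x S ≈ coeff y S

data Label : Set where
  unlab : Label
  labα  : Label
  labαθ : Label

-- an arc {a,b} is stored as the ordered pair (a , b) with a < b
Arc : ℕ → Set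
Arc n = Fin n × Fin n

endpoints : ∀ {n} → List (Arc n) → List (Fin n)
endpoints = concatMap (λ a → proj₁ a ∷ proj₂ a ∷ [])

-- a labelled matching: a set of pairwise disjoint arcs (a list without
-- repetitions, each arc with smaller endpoint first, all endpoints distinct)
-- and a labelling; the label is only used at unmatched vertices.
record LMatching (n : ℕ) : Set where
  constructor lm
  field
    arcs   : List (Arc n)
    label  : Fin n → Label
    arcOrd : All (λ a → proj₁ a < proj₂ a) arcs
    disj   : Unique (endpoints arcs)

open LMatching public

isMatched : ∀ {n} → List (Arc n) → Fin n → Bool
isMatched as v = any (λ u → does (u ≟ᶠ v)) (endpoints as)

module _ {c ℓ : Level} (R : CommutativeRing c ℓ) {n : ℕ} where
  open ExtAlg R n

  αFactor : LMatching n → Fin n → E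
  αFactor m v with isMatched (arcs m) v | label m v
  ... | false | labα = gen (α v)
  ... | _     | _    = oneE

  αθFactor : LMatching n → Fin n → E
  αθFactor m v with isMatched (arcs m) v | label m v
  ... | false | labαθ = gen (α v) ⊗ gen (θ v)
  ... | _     | _     = oneE

  arcFactor : Arc n → E
  arcFactor (a , b) = gen (α a) ⊗ gen (θ b) ⊕ gen (α b) ⊗ gen (θ a)

  F : LMatching n → E
  F m = prodE (map (αFactor m) (allFin n))
      ⊗ prodE (map (αθFactor m) (allFin n))
      ⊗ prodE (map arcFactor (arcs m))

module Submission where

-- Expanding the two crossing arc factors of m, m₀ and m₁ yields twelve monomials α_x θ_y α_z θ_w,
-- all flanked by the same factors: the unmatched vertices on the left and the remaining arcs on the
-- right (arc factors have even degree, so their order does not matter). The twelve monomials cancel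
-- in pairs, the two members of a pair differing by exchanging their two α's or their two θ's.

open import Defs
open import Level using (Level)
open import Algebra.Bundles using (CommutativeRing)
open import Data.Nat using (ℕ; _≤_)
open import Data.Fin using (Fin; _<_)
open import Data.List using (List; _∷_)
open import Data.Product using (_,_)
open import Data.List.Relation.Binary.Permutation.Propositional using (_↭_)
open import Relation.Binary.PropositionalEquality using (_≡_)

open import Level using (_⊔_)
open import Data.Nat as ℕ using (zero; suc)
open import Data.Nat.Properties using (<-irrefl; <-asym; <-trans; <-cmp; m≤m+n)
open import Data.Bool using (Bool; true; false; not; _∨_; if_then_else_)
open import Data.Bool.Properties using (not-involutive; ∨-assoc; ∨-comm)
open import Data.Bool.ListAction using (any)
open import Data.List using ([]; _++_; map; foldr; allFin)
open import Data.List.Properties using (≡-dec; map-cong)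
open import Data.List.Relation.Binary.Permutation.Propositional as ↭ using (↭-sym)
open import Data.List.Relation.Binary.Permutation.Propositional.Properties using (shifts; ++⁺ˡ)
open import Data.Maybe using (Maybe; just; nothing)
open import Data.Product using (_×_; proj₁; proj₂)
open import Data.Empty using (⊥-elim)
open import Function using (_∘_)
open import Relation.Nullary using (yes; no)
open import Relation.Binary using (tri<; tri≈; tri>)
open import Relation.Binary.Bundles using (Setoid)
import Relation.Binary.PropositionalEquality as ≡
import Relation.Binary.Reasoning.Setoid as SetoidReasoning

module SignedNormalForms where
  open ≡ using (refl; cong; sym; trans)
  open ≡.≡-Reasoning

  -- The normal forms computed by normalize: sorted generator codes with a sign, nothing being 0.
  Signed : Set
  Signed = Maybe (List ℕ × Bool)

  negate : Signed → Signed
  negate nothing         = nothing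
  negate (just (zs , p)) = just (zs , not p)

  cons : ℕ → Signed → Signed
  cons y nothing         = nothing
  cons y (just (zs , p)) = just (y ∷ zs , p)

  twist : Bool → Signed → Signed
  twist false N = N
  twist true  N = negate N

  ins : ℕ → Signed → Signed
  ins x nothing         = nothing
  ins x (just (ys , p)) = twist p (insert x ys)

  negate-involutive : ∀ N → negate (negate N) ≡ N
  negate-involutive nothing         = refl
  negate-involutive (just (zs , p)) = cong (λ q → just (zs , q)) (not-involutive p)

  cons-negate : ∀ y N → cons y (negate N) ≡ negate (cons y N)
  cons-negate y nothing  = refl
  cons-negate y (just _) = refl

  twist-negate : ∀ p N → twist p (negate N) ≡ negate (twist p N)
  twist-negate false N = refl
  twist-negate true  N = refl

  twist-cons : ∀ p y N → twist p (cons y N) ≡ cons y (twist p N)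
  twist-cons false y N = refl
  twist-cons true  y N = sym (cons-negate y N)

  ins-negate : ∀ x N → ins x (negate N) ≡ negate (ins x N)
  ins-negate x nothing             = refl
  ins-negate x (just (ys , false)) = refl
  ins-negate x (just (ys , true))  = sym (negate-involutive (insert x ys))

  compare-refl : ∀ x → ℕ.compare x x ≡ ℕ.equal x
  compare-refl zero    = refl
  compare-refl (suc x) rewrite compare-refl x = refl

  1+m+n≮m : ∀ m n → suc (m ℕ.+ n) ℕ.≮ m
  1+m+n≮m m n 1+m+n<m = <-asym 1+m+n<m (ℕ.s≤s (m≤m+n m n))

  insert-< : ∀ {x y} ys → x ℕ.< y → insert x (y ∷ ys) ≡ just (x ∷ y ∷ ys , false)
  insert-< {x} {y} ys x<y with ℕ.compare x y
  ... | ℕ.less _ _    = refl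
  ... | ℕ.equal _     = ⊥-elim (<-irrefl refl x<y)
  ... | ℕ.greater _ k = ⊥-elim (1+m+n≮m y k x<y)

  insert-≡ : ∀ x ys → insert x (x ∷ ys) ≡ nothing
  insert-≡ x ys rewrite compare-refl x = refl

  insert-> : ∀ {x y} ys → y ℕ.< x → insert x (y ∷ ys) ≡ negate (cons y (insert x ys))
  insert-> {x} {y} ys y<x with ℕ.compare x y
  ... | ℕ.less _ k    = ⊥-elim (1+m+n≮m x k y<x)
  ... | ℕ.equal _     = ⊥-elim (<-irrefl refl y<x)
  ... | ℕ.greater _ _ with insert x ys
  ...   | nothing = refl
  ...   | just _  = refl

  ins-nil : ∀ x p → ins x (just ([] , p)) ≡ cons x (just ([] , p))
  ins-nil x false = refl
  ins-nil x true  = refl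

  ins-cons-< : ∀ {x y} → x ℕ.< y → ∀ N → ins x (cons y N) ≡ cons x (cons y N)
  ins-cons-< x<y nothing = refl
  ins-cons-< x<y (just (zs , p)) rewrite insert-< zs x<y with p
  ... | false = refl
  ... | true  = refl

  ins-cons-≡ : ∀ x N → ins x (cons x N) ≡ nothing
  ins-cons-≡ x nothing = refl
  ins-cons-≡ x (just (zs , p)) rewrite insert-≡ x zs with p
  ... | false = refl
  ... | true  = refl

  ins-cons-> : ∀ {x y} → y ℕ.< x → ∀ N → ins x (cons y N) ≡ negate (cons y (ins x N))
  ins-cons-> y<x nothing = refl
  ins-cons-> {x} {y} y<x (just (zs , p)) = begin
    twist p (insert x (y ∷ zs))            ≡⟨ cong (twist p) (insert-> zs y<x) ⟩
    twist p (negate (cons y (insert x zs))) ≡⟨ twist-negate p _ ⟩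
    negate (twist p (cons y (insert x zs))) ≡⟨ cong negate (twist-cons p y _) ⟩
    negate (cons y (twist p (insert x zs))) ∎

  ins-negate-cons : ∀ {x y} → y ℕ.< x → ∀ N → ins x (negate (cons y N)) ≡ cons y (ins x N)
  ins-negate-cons {x} {y} y<x N = begin
    ins x (negate (cons y N))          ≡⟨ ins-negate x (cons y N) ⟩
    negate (ins x (cons y N))          ≡⟨ cong negate (ins-cons-> y<x N) ⟩
    negate (negate (cons y (ins x N))) ≡⟨ negate-involutive _ ⟩
    cons y (ins x N)                   ∎

  negate-ins-cons : ∀ {x y} → y ℕ.< x → ∀ N → negate (ins x (cons y N)) ≡ cons y (ins x N)
  negate-ins-cons y<x N = trans (cong negate (ins-cons-> y<x N)) (negate-involutive _)

  ins-ins-≡ : ∀ x N → ins x (ins x N) ≡ nothing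
  ins-ins-≡ x nothing         = refl
  ins-ins-≡ x (just (ys , p)) = go ys
    where
    go : ∀ ys → ins x (ins x (just (ys , p))) ≡ nothing
    go []       = trans (cong (ins x) (ins-nil x p)) (ins-cons-≡ x (just ([] , p)))
    go (y ∷ ys) with <-cmp x y
    ... | tri< x<y _ _  = trans (cong (ins x) (ins-cons-< x<y (just (ys , p)))) (ins-cons-≡ x (cons y (just (ys , p))))
    ... | tri≈ _ refl _ = cong (ins x) (ins-cons-≡ x (just (ys , p)))
    ... | tri> _ _ y<x  = begin
      ins x (ins x (cons y M))          ≡⟨ cong (ins x) (ins-cons-> y<x M) ⟩
      ins x (negate (cons y (ins x M))) ≡⟨ ins-negate-cons y<x (ins x M) ⟩
      cons y (ins x (ins x M))          ≡⟨ cong (cons y) (go ys) ⟩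
      nothing                           ∎
      where M = just (ys , p)

  ins-anticomm-<-below : ∀ {x y z} → x ℕ.< y → x ℕ.< z → ∀ M →
    ins x (ins y (cons z M)) ≡ negate (ins y (ins x (cons z M)))
  ins-anticomm-<-below {x} {y} {z} x<y x<z M with <-cmp y z
  ... | tri< y<z _ _ = begin
    ins x (ins y (cons z M))            ≡⟨ cong (ins x) (ins-cons-< y<z M) ⟩
    ins x (cons y (cons z M))           ≡⟨ ins-cons-< x<y (cons z M) ⟩
    cons x (cons y (cons z M))          ≡⟨ cong (cons x) (sym (ins-cons-< y<z M)) ⟩
    cons x (ins y (cons z M))           ≡⟨ sym (negate-ins-cons x<y (cons z M)) ⟩
    negate (ins y (cons x (cons z M)))  ≡⟨ cong (negate ∘ ins y) (sym (ins-cons-< x<z M)) ⟩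
    negate (ins y (ins x (cons z M)))   ∎
  ... | tri≈ _ refl _ = begin
    ins x (ins y (cons y M))            ≡⟨ cong (ins x) (ins-cons-≡ y M) ⟩
    nothing                             ≡⟨ cong (cons x) (sym (ins-cons-≡ y M)) ⟩
    cons x (ins y (cons y M))           ≡⟨ sym (negate-ins-cons x<y (cons y M)) ⟩
    negate (ins y (cons x (cons y M)))  ≡⟨ cong (negate ∘ ins y) (sym (ins-cons-< x<z M)) ⟩
    negate (ins y (ins x (cons y M)))   ∎
  ... | tri> _ _ z<y = begin
    ins x (ins y (cons z M))                     ≡⟨ cong (ins x) (ins-cons-> z<y M) ⟩
    ins x (negate (cons z (ins y M)))            ≡⟨ ins-negate x (cons z (ins y M)) ⟩
    negate (ins x (cons z (ins y M)))            ≡⟨ cong negate (ins-cons-< x<z (ins y M)) ⟩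
    negate (cons x (cons z (ins y M)))           ≡⟨ cong (negate ∘ cons x) (sym (negate-ins-cons z<y M)) ⟩
    negate (cons x (negate (ins y (cons z M))))  ≡⟨ cong negate (cons-negate x _) ⟩
    negate (negate (cons x (ins y (cons z M))))  ≡⟨ cong negate (sym (ins-cons-> x<y (cons z M))) ⟩
    negate (ins y (cons x (cons z M)))           ≡⟨ cong (negate ∘ ins y) (sym (ins-cons-< x<z M)) ⟩
    negate (ins y (ins x (cons z M)))            ∎

  ins-anticomm-< : ∀ {x y} → x ℕ.< y → ∀ N → ins x (ins y N) ≡ negate (ins y (ins x N))
  ins-anticomm-< x<y nothing         = refl
  ins-anticomm-< {x} {y} x<y (just (ys , p)) = go ys
    where
    go : ∀ ys → ins x (ins y (just (ys , p))) ≡ negate (ins y (ins x (just (ys , p))))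
    go [] = begin
      ins x (ins y M)            ≡⟨ cong (ins x) (ins-nil y p) ⟩
      ins x (cons y M)           ≡⟨ ins-cons-< x<y M ⟩
      cons x (cons y M)          ≡⟨ cong (cons x) (sym (ins-nil y p)) ⟩
      cons x (ins y M)           ≡⟨ sym (negate-ins-cons x<y M) ⟩
      negate (ins y (cons x M))  ≡⟨ cong (negate ∘ ins y) (sym (ins-nil x p)) ⟩
      negate (ins y (ins x M))   ∎
      where M = just ([] , p)
    go (z ∷ zs) with <-cmp x z
    ... | tri< x<z _ _  = ins-anticomm-<-below x<y x<z (just (zs , p))
    ... | tri≈ _ refl _ = begin
      ins x (ins y (cons x M))          ≡⟨ cong (ins x) (ins-cons-> x<y M) ⟩
      ins x (negate (cons x (ins y M))) ≡⟨ ins-negate x (cons x (ins y M)) ⟩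
      negate (ins x (cons x (ins y M))) ≡⟨ cong negate (ins-cons-≡ x (ins y M)) ⟩
      nothing                           ≡⟨ cong (negate ∘ ins y) (sym (ins-cons-≡ x M)) ⟩
      negate (ins y (ins x (cons x M))) ∎
      where M = just (zs , p)
    ... | tri> _ _ z<x  = begin
      ins x (ins y (cons z M))                    ≡⟨ cong (ins x) (ins-cons-> z<y M) ⟩
      ins x (negate (cons z (ins y M)))           ≡⟨ ins-negate-cons z<x (ins y M) ⟩
      cons z (ins x (ins y M))                    ≡⟨ cong (cons z) (go zs) ⟩
      cons z (negate (ins y (ins x M)))           ≡⟨ cons-negate z _ ⟩
      negate (cons z (ins y (ins x M)))           ≡⟨ cong negate (sym (ins-negate-cons z<y (ins x M))) ⟩
      negate (ins y (negate (cons z (ins x M))))  ≡⟨ cong (negate ∘ ins y) (sym (ins-cons-> z<x M)) ⟩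
      negate (ins y (ins x (cons z M)))           ∎
      where
      M = just (zs , p)
      z<y = <-trans z<x x<y

  ins-anticomm : ∀ x y N → ins x (ins y N) ≡ negate (ins y (ins x N))
  ins-anticomm x y N with <-cmp x y
  ... | tri< x<y _ _  = ins-anticomm-< x<y N
  ... | tri≈ _ refl _ = trans (ins-ins-≡ x N) (cong negate (sym (ins-ins-≡ x N)))
  ... | tri> _ _ y<x  = begin
    ins x (ins y N)                   ≡⟨ sym (negate-involutive _) ⟩
    negate (negate (ins x (ins y N))) ≡⟨ cong negate (sym (ins-anticomm-< y<x N)) ⟩
    negate (ins y (ins x N))          ∎

  ins-reverse₃ : ∀ a b c N → ins a (ins b (ins c N)) ≡ negate (ins c (ins b (ins a N)))
  ins-reverse₃ a b c N = begin
    ins a (ins b (ins c N))                    ≡⟨ ins-anticomm a b (ins c N) ⟩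
    negate (ins b (ins a (ins c N)))           ≡⟨ cong (negate ∘ ins b) (ins-anticomm a c N) ⟩
    negate (ins b (negate (ins c (ins a N))))  ≡⟨ cong negate (ins-negate b (ins c (ins a N))) ⟩
    negate (negate (ins b (ins c (ins a N))))  ≡⟨ negate-involutive _ ⟩
    ins b (ins c (ins a N))                    ≡⟨ ins-anticomm b c (ins a N) ⟩
    negate (ins c (ins b (ins a N)))           ∎

  normalize-∷ : ∀ x xs → normalize (x ∷ xs) ≡ ins x (normalize xs)
  normalize-∷ x xs with normalize xs
  ... | nothing = refl
  ... | just (ys , p) with insert x ys | p
  ...   | nothing       | false = refl
  ...   | nothing       | true  = refl
  ...   | just (zs , q) | false = refl
  ...   | just (zs , q) | true  = refl

open SignedNormalForms

module ArcPairs {c ℓ a : Level} (R : CommutativeRing c ℓ) {I : Set a} where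
  open CommutativeRing R renaming (Carrier to K)
  open import Algebra.Properties.Ring ring using (-‿involutive)
  open import Algebra.Properties.CommutativeSemigroup +-commutativeSemigroup using (interchange)
  open import Algebra.Solver.CommutativeMonoid +-commutativeMonoid using (solve; _⊜_) renaming (_⊕_ to _⊞_)
  open import Relation.Binary.Reasoning.Setoid setoid

  Alternating₁₃ : (I → I → I → I → K) → Set (a ⊔ ℓ)
  Alternating₁₃ δ = ∀ x y z w → δ x y z w ≈ - δ z y x w

  Alternating₂₄ : (I → I → I → I → K) → Set (a ⊔ ℓ)
  Alternating₂₄ δ = ∀ x y z w → δ x y z w ≈ - δ x w z y

  -- δ x y z w stands for the monomial α_x θ_y α_z θ_w, so arcPair δ a b c d is the expansion of the
  -- product of the arc factors of {a,b} and {c,d}.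
  arcPair : (I → I → I → I → K) → I → I → I → I → K
  arcPair δ a b c d = (δ a b c d + δ a b d c) + (δ b a c d + δ b a d c)

  module _ {δ : I → I → I → I → K} (alt₁₃ : Alternating₁₃ δ) (alt₂₄ : Alternating₂₄ δ) where

    swap-pairs : ∀ x y z w → δ x y z w ≈ δ z w x y
    swap-pairs x y z w = begin
      δ x y z w       ≈⟨ alt₁₃ x y z w ⟩
      - δ z y x w     ≈⟨ -‿cong (alt₂₄ z y x w) ⟩
      - - δ z w x y   ≈⟨ -‿involutive _ ⟩
      δ z w x y       ∎

    arcPair-comm : ∀ a b c d → arcPair δ a b c d ≈ arcPair δ c d a b
    arcPair-comm a b c d = begin
      (δ a b c d + δ a b d c) + (δ b a c d + δ b a d c)
        ≈⟨ +-cong (+-cong (swap-pairs a b c d) (swap-pairs a b d c))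
                  (+-cong (swap-pairs b a c d) (swap-pairs b a d c)) ⟩
      (δ c d a b + δ d c a b) + (δ c d b a + δ d c b a)
        ≈⟨ interchange _ _ _ _ ⟩
      (δ c d a b + δ c d b a) + (δ d c a b + δ d c b a) ∎

    arcPair-threeTerm : ∀ i j k l → arcPair δ i k j l + arcPair δ i j k l + arcPair δ i l j k ≈ 0#
    arcPair-threeTerm i j k l = begin
      arcPair δ i k j l + arcPair δ i j k l + arcPair δ i l j k
        ≈⟨ +-cong (+-congˡ (+-cong (+-congˡ (alt₂₄ i j l k)) (+-congʳ (alt₁₃ j i k l))))
                  (+-cong (+-cong (alt₂₄ i l j k) (alt₂₄ i l k j)) (+-cong (alt₁₃ l i j k) (alt₁₃ l i k j))) ⟩
      ((A + B) + (C + D)) + ((E + - B) + (- C + G)) + ((- A + - E) + (- G + - D))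
        ≈⟨ regroup A B C D E G (- A) (- B) (- C) (- D) (- E) (- G) ⟩
      (A - A) + ((B - B) + ((C - C) + ((D - D) + ((E - E) + (G - G)))))
        ≈⟨ zero-sum ⟩
      0# ∎
      where
      A = δ i k j l
      B = δ i k l j
      C = δ k i j l
      D = δ k i l j
      E = δ i j k l
      G = δ j i l k
      -- The monoid solver cannot cancel, so the negated terms enter as separate variables.
      regroup : ∀ a b c d e g a′ b′ c′ d′ e′ g′ →
        ((a + b) + (c + d)) + ((e + b′) + (c′ + g)) + ((a′ + e′) + (g′ + d′))
          ≈ (a + a′) + ((b + b′) + ((c + c′) + ((d + d′) + ((e + e′) + (g + g′)))))
      regroup = solve 12 (λ a b c d e g a′ b′ c′ d′ e′ g′ →
        (((a ⊞ b) ⊞ (c ⊞ d)) ⊞ ((e ⊞ b′) ⊞ (c′ ⊞ g))) ⊞ ((a′ ⊞ e′) ⊞ (g′ ⊞ d′))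
          ⊜ (a ⊞ a′) ⊞ ((b ⊞ b′) ⊞ ((c ⊞ c′) ⊞ ((d ⊞ d′) ⊞ ((e ⊞ e′) ⊞ (g ⊞ g′)))))) refl
      zero-sum : (A - A) + ((B - B) + ((C - C) + ((D - D) + ((E - E) + (G - G))))) ≈ 0#
      zero-sum = cancel A (cancel B (cancel C (cancel D (cancel E (-‿inverseʳ G)))))
        where
        cancel : ∀ x {y} → y ≈ 0# → (x - x) + y ≈ 0#
        cancel x y≈0 = trans (+-cong (-‿inverseʳ x) y≈0) (+-identityˡ 0#)

module Words {n : ℕ} where

  sign : List (Gen n) → Signed
  sign w = normalize (map code w)

  insWord : List (Gen n) → Signed → Signed
  insWord v N = foldr (ins ∘ code) N v

  sign-++ : ∀ v w → sign (v ++ w) ≡ insWord v (sign w)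
  sign-++ []      w = ≡.refl
  sign-++ (g ∷ v) w = ≡.trans (normalize-∷ (code g) (map code (v ++ w))) (≡.cong (ins (code g)) (sign-++ v w))

  insWord-negate : ∀ v N → insWord v (negate N) ≡ negate (insWord v N)
  insWord-negate []      N = ≡.refl
  insWord-negate (g ∷ v) N = ≡.trans (≡.cong (ins (code g)) (insWord-negate v N)) (ins-negate (code g) (insWord v N))

open Words

module OddFunctionals {c ℓ : Level} (R : CommutativeRing c ℓ) (n : ℕ) where
  open CommutativeRing R renaming (Carrier to K)
  open ExtAlg R n
  open import Algebra.Properties.Ring ring using (-0#≈0#; -‿involutive; -‿distribʳ-*; -‿+-comm)
  open import Algebra.Properties.CommutativeSemigroup +-commutativeSemigroup using (interchange)
  open import Relation.Binary.Reasoning.Setoid setoid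

  Odd : (Signed → K) → Set ℓ
  Odd κ = ∀ N → κ (negate N) ≈ - κ N

  odd-∘-insWord : ∀ {κ} (v : List (Gen n)) → Odd κ → Odd (κ ∘ insWord v)
  odd-∘-insWord {κ} v odd N = trans (reflexive (≡.cong κ (insWord-negate v N))) (odd (insWord v N))

  infix 4 ⟨_∣_⟩
  ⟨_∣_⟩ : (Signed → K) → E → K
  ⟨ κ ∣ [] ⟩          = 0#
  ⟨ κ ∣ (s , w) ∷ y ⟩ = s * κ (sign w) + ⟨ κ ∣ y ⟩

  coeffAt : List ℕ → Signed → K
  coeffAt S nothing = 0#
  coeffAt S (just (zs , p)) with ≡-dec ℕ._≟_ zs S
  ... | no _  = 0#
  ... | yes _ = if p then - 1# else 1#

  coeffAt-odd : ∀ S → Odd (coeffAt S)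
  coeffAt-odd S nothing = sym -0#≈0#
  coeffAt-odd S (just (zs , p)) with ≡-dec ℕ._≟_ zs S
  ... | no _ = sym -0#≈0#
  coeffAt-odd S (just (zs , false)) | yes _ = refl
  coeffAt-odd S (just (zs , true))  | yes _ = sym (-‿involutive 1#)

  termCoeff-coeffAt : ∀ r w S → termCoeff (r , w) S ≈ r * coeffAt S (sign w)
  termCoeff-coeffAt r w S with normalize (map code w)
  ... | nothing = sym (zeroʳ r)
  ... | just (zs , p) with ≡-dec ℕ._≟_ zs S
  ...   | no _ = sym (zeroʳ r)
  termCoeff-coeffAt r w S | just (zs , false) | yes _ = sym (*-identityʳ r)
  termCoeff-coeffAt r w S | just (zs , true)  | yes _ =
    trans (-‿cong (sym (*-identityʳ r))) (-‿distribʳ-* r 1#)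

  coeff-⟨⟩ : ∀ x S → coeff x S ≈ ⟨ coeffAt S ∣ x ⟩
  coeff-⟨⟩ []            S = refl
  coeff-⟨⟩ ((r , w) ∷ x) S = +-cong (termCoeff-coeffAt r w S) (coeff-⟨⟩ x S)

  ⟨⟩-++ : ∀ κ x y → ⟨ κ ∣ x ++ y ⟩ ≈ ⟨ κ ∣ x ⟩ + ⟨ κ ∣ y ⟩
  ⟨⟩-++ κ []      y = sym (+-identityˡ _)
  ⟨⟩-++ κ (t ∷ x) y = trans (+-congˡ (⟨⟩-++ κ x y)) (sym (+-assoc _ _ _))

  ⟨⟩-⊗-∷ : ∀ κ r v z y → ⟨ κ ∣ ((r , v) ∷ z) ⊗ y ⟩ ≈ r * ⟨ κ ∘ insWord v ∣ y ⟩ + ⟨ κ ∣ z ⊗ y ⟩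
  ⟨⟩-⊗-∷ κ r v z y = trans (⟨⟩-++ κ (map scaled y) (z ⊗ y)) (+-congʳ (⟨⟩-scaled y))
    where
    scaled : K × List (Gen n) → K × List (Gen n)
    scaled s = r * proj₁ s , v ++ proj₂ s

    ⟨⟩-scaled : ∀ y → ⟨ κ ∣ map scaled y ⟩ ≈ r * ⟨ κ ∘ insWord v ∣ y ⟩
    ⟨⟩-scaled []            = sym (zeroʳ r)
    ⟨⟩-scaled ((s , w) ∷ y) = begin
      r * s * κ (sign (v ++ w)) + ⟨ κ ∣ map scaled y ⟩
        ≈⟨ +-cong (trans (*-assoc r s _) (*-congˡ (*-congˡ (reflexive (≡.cong κ (sign-++ v w))))))
                  (⟨⟩-scaled y) ⟩
      r * (s * κ (insWord v (sign w))) + r * ⟨ κ ∘ insWord v ∣ y ⟩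
        ≈⟨ distribˡ r _ _ ⟨
      r * ⟨ κ ∘ insWord v ∣ (s , w) ∷ y ⟩ ∎

  -- Agreement under every odd functional: it implies ≋ since coefficient extraction is odd, and
  -- unlike a single coefficient it survives left multiplication (odd-∘-insWord).
  infix 4 _≈ᵒ_
  record _≈ᵒ_ (x y : E) : Set (c ⊔ ℓ) where
    field at : ∀ κ → Odd κ → ⟨ κ ∣ x ⟩ ≈ ⟨ κ ∣ y ⟩
  open _≈ᵒ_ public

  ≈ᵒ-setoid : Setoid c (c ⊔ ℓ)
  ≈ᵒ-setoid = record
    { Carrier       = E
    ; _≈_           = _≈ᵒ_
    ; isEquivalence = record
      { refl  = record { at = λ _ _ → refl }
      ; sym   = λ x≈y → record { at = λ κ odd → sym (x≈y .at κ odd) }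
      ; trans = λ x≈y y≈z → record { at = λ κ odd → trans (x≈y .at κ odd) (y≈z .at κ odd) }
      }
    }

  module ≈ᵒ = Setoid ≈ᵒ-setoid

  ≈ᵒ⇒≋ : ∀ {x y} → x ≈ᵒ y → x ≋ y
  ≈ᵒ⇒≋ {x} {y} x≈y S = begin
    coeff x S           ≈⟨ coeff-⟨⟩ x S ⟩
    ⟨ coeffAt S ∣ x ⟩   ≈⟨ x≈y .at (coeffAt S) (coeffAt-odd S) ⟩
    ⟨ coeffAt S ∣ y ⟩   ≈⟨ coeff-⟨⟩ y S ⟨
    coeff y S           ∎

  ⊕-cong : ∀ {x x′ y y′} → x ≈ᵒ x′ → y ≈ᵒ y′ → x ⊕ y ≈ᵒ x′ ⊕ y′
  ⊕-cong {x} {x′} {y} {y′} x≈x′ y≈y′ .at κ odd = begin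
    ⟨ κ ∣ x ⊕ y ⟩             ≈⟨ ⟨⟩-++ κ x y ⟩
    ⟨ κ ∣ x ⟩ + ⟨ κ ∣ y ⟩     ≈⟨ +-cong (x≈x′ .at κ odd) (y≈y′ .at κ odd) ⟩
    ⟨ κ ∣ x′ ⟩ + ⟨ κ ∣ y′ ⟩   ≈⟨ ⟨⟩-++ κ x′ y′ ⟨
    ⟨ κ ∣ x′ ⊕ y′ ⟩           ∎

  ⊗-congˡ : ∀ z {y y′} → y ≈ᵒ y′ → z ⊗ y ≈ᵒ z ⊗ y′
  ⊗-congˡ []            y≈y′ .at κ odd = refl
  ⊗-congˡ ((r , v) ∷ z) {y} {y′} y≈y′ .at κ odd = begin
    ⟨ κ ∣ ((r , v) ∷ z) ⊗ y ⟩
      ≈⟨ ⟨⟩-⊗-∷ κ r v z y ⟩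
    r * ⟨ κ ∘ insWord v ∣ y ⟩ + ⟨ κ ∣ z ⊗ y ⟩
      ≈⟨ +-cong (*-congˡ (y≈y′ .at (κ ∘ insWord v) (odd-∘-insWord v odd))) (⊗-congˡ z y≈y′ .at κ odd) ⟩
    r * ⟨ κ ∘ insWord v ∣ y′ ⟩ + ⟨ κ ∣ z ⊗ y′ ⟩
      ≈⟨ ⟨⟩-⊗-∷ κ r v z y′ ⟨
    ⟨ κ ∣ ((r , v) ∷ z) ⊗ y′ ⟩ ∎

  ⊗-distribˡ-⊕ : ∀ z y y′ → z ⊗ (y ⊕ y′) ≈ᵒ z ⊗ y ⊕ z ⊗ y′
  ⊗-distribˡ-⊕ []            y y′ .at κ odd = refl
  ⊗-distribˡ-⊕ ((r , v) ∷ z) y y′ .at κ odd = begin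
    ⟨ κ ∣ ((r , v) ∷ z) ⊗ (y ⊕ y′) ⟩
      ≈⟨ ⟨⟩-⊗-∷ κ r v z (y ⊕ y′) ⟩
    r * ⟨ κ′ ∣ y ⊕ y′ ⟩ + ⟨ κ ∣ z ⊗ (y ⊕ y′) ⟩
      ≈⟨ +-cong (trans (*-congˡ (⟨⟩-++ κ′ y y′)) (distribˡ r _ _))
                (trans (⊗-distribˡ-⊕ z y y′ .at κ odd) (⟨⟩-++ κ (z ⊗ y) (z ⊗ y′))) ⟩
    (r * ⟨ κ′ ∣ y ⟩ + r * ⟨ κ′ ∣ y′ ⟩) + (⟨ κ ∣ z ⊗ y ⟩ + ⟨ κ ∣ z ⊗ y′ ⟩)
      ≈⟨ interchange _ _ _ _ ⟩
    (r * ⟨ κ′ ∣ y ⟩ + ⟨ κ ∣ z ⊗ y ⟩) + (r * ⟨ κ′ ∣ y′ ⟩ + ⟨ κ ∣ z ⊗ y′ ⟩)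
      ≈⟨ +-cong (⟨⟩-⊗-∷ κ r v z y) (⟨⟩-⊗-∷ κ r v z y′) ⟨
    ⟨ κ ∣ ((r , v) ∷ z) ⊗ y ⟩ + ⟨ κ ∣ ((r , v) ∷ z) ⊗ y′ ⟩
      ≈⟨ ⟨⟩-++ κ (((r , v) ∷ z) ⊗ y) (((r , v) ∷ z) ⊗ y′) ⟨
    ⟨ κ ∣ ((r , v) ∷ z) ⊗ y ⊕ ((r , v) ∷ z) ⊗ y′ ⟩ ∎
    where κ′ = κ ∘ insWord v

  ⊗-zeroʳ : ∀ z → z ⊗ zeroE ≡ zeroE
  ⊗-zeroʳ []      = ≡.refl
  ⊗-zeroʳ (t ∷ z) = ⊗-zeroʳ z

  ⟨⟩-negate : ∀ {κ κ′} → (∀ N → κ N ≈ - κ′ N) → ∀ y → ⟨ κ ∣ y ⟩ ≈ - ⟨ κ′ ∣ y ⟩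
  ⟨⟩-negate κ≈-κ′ []            = sym -0#≈0#
  ⟨⟩-negate {κ} {κ′} κ≈-κ′ ((s , w) ∷ y) = begin
    s * κ (sign w) + ⟨ κ ∣ y ⟩          ≈⟨ +-cong (*-congˡ (κ≈-κ′ (sign w))) (⟨⟩-negate κ≈-κ′ y) ⟩
    s * - κ′ (sign w) + - ⟨ κ′ ∣ y ⟩    ≈⟨ +-congʳ (-‿distribʳ-* s _) ⟨
    - (s * κ′ (sign w)) + - ⟨ κ′ ∣ y ⟩  ≈⟨ -‿+-comm _ _ ⟩
    - ⟨ κ′ ∣ (s , w) ∷ y ⟩              ∎

  open ArcPairs R {I = Fin n}

  αθ : Fin n → Fin n → List (Gen n)
  αθ a b = α a ∷ θ b ∷ []

  ⟨⟩-arc : ∀ κ a b y →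
    ⟨ κ ∣ arcFactor R (a , b) ⊗ y ⟩ ≈ ⟨ κ ∘ insWord (αθ a b) ∣ y ⟩ + ⟨ κ ∘ insWord (αθ b a) ∣ y ⟩
  ⟨⟩-arc κ a b y = begin
    ⟨ κ ∣ arcFactor R (a , b) ⊗ y ⟩
      ≈⟨ trans (⟨⟩-⊗-∷ κ (1# * 1#) (αθ a b) ((1# * 1# , αθ b a) ∷ []) y) (+-congˡ (⟨⟩-⊗-∷ κ (1# * 1#) (αθ b a) [] y)) ⟩
    1# * 1# * ⟨ κ ∘ insWord (αθ a b) ∣ y ⟩ + (1# * 1# * ⟨ κ ∘ insWord (αθ b a) ∣ y ⟩ + 0#)
      ≈⟨ +-cong (1#*1#*-identity _) (trans (+-identityʳ _) (1#*1#*-identity _)) ⟩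
    ⟨ κ ∘ insWord (αθ a b) ∣ y ⟩ + ⟨ κ ∘ insWord (αθ b a) ∣ y ⟩ ∎
    where
    1#*1#*-identity : ∀ x → 1# * 1# * x ≈ x
    1#*1#*-identity x = trans (*-congʳ (*-identityˡ 1#)) (*-identityˡ x)

  arcPairing : (Signed → K) → E → Fin n → Fin n → Fin n → Fin n → K
  arcPairing κ y a b c d = ⟨ κ ∘ insWord (αθ a b) ∘ insWord (αθ c d) ∣ y ⟩

  ⟨⟩-arc-arc : ∀ κ a b c d y →
    ⟨ κ ∣ arcFactor R (a , b) ⊗ (arcFactor R (c , d) ⊗ y) ⟩ ≈ arcPair (arcPairing κ y) a b c d
  ⟨⟩-arc-arc κ a b c d y = trans (⟨⟩-arc κ a b (arcFactor R (c , d) ⊗ y))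
    (+-cong (⟨⟩-arc (κ ∘ insWord (αθ a b)) c d y) (⟨⟩-arc (κ ∘ insWord (αθ b a)) c d y))

  arcPairing-alternating₁₃ : ∀ {κ} → Odd κ → ∀ y → Alternating₁₃ (arcPairing κ y)
  arcPairing-alternating₁₃ {κ} odd y a b c d = ⟨⟩-negate reverse y
    where
    reverse : ∀ N → κ (insWord (αθ a b) (insWord (αθ c d) N)) ≈ - κ (insWord (αθ c b) (insWord (αθ a d) N))
    reverse N = trans (reflexive (≡.cong κ (ins-reverse₃ (code (α a)) (code (θ b)) (code (α c)) (ins (code (θ d)) N))))
                      (odd _)

  arcPairing-alternating₂₄ : ∀ {κ} → Odd κ → ∀ y → Alternating₂₄ (arcPairing κ y)
  arcPairing-alternating₂₄ {κ} odd y a b c d = ⟨⟩-negate reverse y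
    where
    reverse : ∀ N → κ (insWord (αθ a b) (insWord (αθ c d) N)) ≈ - κ (insWord (αθ a d) (insWord (αθ c b) N))
    reverse N = trans (reflexive (≡.cong κ (≡.trans
                  (≡.cong (ins (code (α a))) (ins-reverse₃ (code (θ b)) (code (α c)) (code (θ d)) N))
                  (ins-negate (code (α a)) (ins (code (θ d)) (ins (code (α c)) (ins (code (θ b)) N)))))))
                (odd _)

  arcFactor-comm : ∀ p q y → arcFactor R p ⊗ (arcFactor R q ⊗ y) ≈ᵒ arcFactor R q ⊗ (arcFactor R p ⊗ y)
  arcFactor-comm (a , b) (c , d) y .at κ odd = begin
    ⟨ κ ∣ arcFactor R (a , b) ⊗ (arcFactor R (c , d) ⊗ y) ⟩ ≈⟨ ⟨⟩-arc-arc κ a b c d y ⟩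
    arcPair (arcPairing κ y) a b c d                       ≈⟨ arcPair-comm alt₁₃ alt₂₄ a b c d ⟩
    arcPair (arcPairing κ y) c d a b                       ≈⟨ ⟨⟩-arc-arc κ c d a b y ⟨
    ⟨ κ ∣ arcFactor R (c , d) ⊗ (arcFactor R (a , b) ⊗ y) ⟩ ∎
    where
    alt₁₃ = arcPairing-alternating₁₃ odd y
    alt₂₄ = arcPairing-alternating₂₄ odd y

  arcProduct : List (Arc n) → E
  arcProduct L = prodE (map (arcFactor R) L)

  arcProduct-↭ : ∀ {L L′} → L ↭ L′ → arcProduct L ≈ᵒ arcProduct L′
  arcProduct-↭ ↭.refl                 = ≈ᵒ.refl
  arcProduct-↭ (↭.prep p L↭L′)        = ⊗-congˡ (arcFactor R p) (arcProduct-↭ L↭L′)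
  arcProduct-↭ (↭.swap {xs = L} p q L↭L′) = ≈ᵒ.trans (arcFactor-comm p q (arcProduct L))
    (⊗-congˡ (arcFactor R q) (⊗-congˡ (arcFactor R p) (arcProduct-↭ L↭L′)))
  arcProduct-↭ (↭.trans L↭L′ L′↭L″)   = ≈ᵒ.trans (arcProduct-↭ L↭L′) (arcProduct-↭ L′↭L″)

  arcProduct-threeTerm : ∀ i j k l rest →
    arcProduct ((i , k) ∷ (j , l) ∷ rest) ⊕ arcProduct ((i , j) ∷ (k , l) ∷ rest) ⊕ arcProduct ((i , l) ∷ (j , k) ∷ rest)
      ≈ᵒ zeroE
  arcProduct-threeTerm i j k l rest .at κ odd = begin
    ⟨ κ ∣ A ⊕ A₀ ⊕ A₁ ⟩
      ≈⟨ trans (⟨⟩-++ κ (A ⊕ A₀) A₁) (+-congʳ (⟨⟩-++ κ A A₀)) ⟩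
    ⟨ κ ∣ A ⟩ + ⟨ κ ∣ A₀ ⟩ + ⟨ κ ∣ A₁ ⟩
      ≈⟨ +-cong (+-cong (⟨⟩-arc-arc κ i k j l Y) (⟨⟩-arc-arc κ i j k l Y)) (⟨⟩-arc-arc κ i l j k Y) ⟩
    arcPair δ i k j l + arcPair δ i j k l + arcPair δ i l j k
      ≈⟨ arcPair-threeTerm (arcPairing-alternating₁₃ odd Y) (arcPairing-alternating₂₄ odd Y) i j k l ⟩
    0# ∎
    where
    Y  = arcProduct rest
    δ  = arcPairing κ Y
    A  = arcProduct ((i , k) ∷ (j , l) ∷ rest)
    A₀ = arcProduct ((i , j) ∷ (k , l) ∷ rest)
    A₁ = arcProduct ((i , l) ∷ (j , k) ∷ rest)

module MatchedVertices where
  open ≡ using (refl; cong; cong₂; sym; trans)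

  any-↭ : ∀ {A : Set} (f : A → Bool) {xs ys} → xs ↭ ys → any f xs ≡ any f ys
  any-↭ f ↭.refl           = refl
  any-↭ f (↭.prep x p)     = cong (f x ∨_) (any-↭ f p)
  any-↭ f (↭.swap {xs} {ys} x y p) = begin
    f x ∨ (f y ∨ any f xs) ≡⟨ cong (λ r → f x ∨ (f y ∨ r)) (any-↭ f p) ⟩
    f x ∨ (f y ∨ any f ys) ≡⟨ sym (∨-assoc (f x) (f y) _) ⟩
    (f x ∨ f y) ∨ any f ys ≡⟨ cong (_∨ any f ys) (∨-comm (f x) (f y)) ⟩
    (f y ∨ f x) ∨ any f ys ≡⟨ ∨-assoc (f y) (f x) _ ⟩
    f y ∨ (f x ∨ any f ys) ∎
    where open ≡.≡-Reasoning
  any-↭ f (↭.trans p q)    = trans (any-↭ f p) (any-↭ f q)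

  endpoints-↭ : ∀ {n} {L L′ : List (Arc n)} → L ↭ L′ → endpoints L ↭ endpoints L′
  endpoints-↭ ↭.refl                        = ↭.refl
  endpoints-↭ (↭.prep (a , b) p)            = ↭.prep a (↭.prep b (endpoints-↭ p))
  endpoints-↭ (↭.swap (a , b) (c , d) p)    =
    ↭.trans (shifts (a ∷ b ∷ []) (c ∷ d ∷ [])) (++⁺ˡ (c ∷ d ∷ a ∷ b ∷ []) (endpoints-↭ p))
  endpoints-↭ (↭.trans p q)                 = ↭.trans (endpoints-↭ p) (endpoints-↭ q)

  module _ {n} (i j k l : Fin n) (rest : List (Arc n)) where

    endpoints-resolution₀ : endpoints ((i , j) ∷ (k , l) ∷ rest) ↭ endpoints ((i , k) ∷ (j , l) ∷ rest)
    endpoints-resolution₀ = ↭.prep i (↭.swap j k ↭.refl)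

    endpoints-resolution₁ : endpoints ((i , l) ∷ (j , k) ∷ rest) ↭ endpoints ((i , k) ∷ (j , l) ∷ rest)
    endpoints-resolution₁ =
      ↭.prep i (↭.trans (↭.swap l j ↭.refl) (↭.trans (↭.prep j (↭.swap l k ↭.refl)) (↭.swap j k ↭.refl)))

  module _ {c ℓ : Level} (R : CommutativeRing c ℓ) {n : ℕ} where
    open ExtAlg R n

    unmatchedPart : LMatching n → E
    unmatchedPart m = prodE (map (αFactor R m) (allFin n)) ⊗ prodE (map (αθFactor R m) (allFin n))

    αFactor-cong : ∀ {m m′ : LMatching n} v → isMatched (arcs m) v ≡ isMatched (arcs m′) v →
      label m v ≡ label m′ v → αFactor R m v ≡ αFactor R m′ v
    αFactor-cong {m} {m′} v matched labelled
      with isMatched (arcs m) v | label m v | isMatched (arcs m′) v | label m′ v | matched | labelled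
    ... | true  | _     | _ | _ | refl | refl = refl
    ... | false | unlab | _ | _ | refl | refl = refl
    ... | false | labα  | _ | _ | refl | refl = refl
    ... | false | labαθ | _ | _ | refl | refl = refl

    αθFactor-cong : ∀ {m m′ : LMatching n} v → isMatched (arcs m) v ≡ isMatched (arcs m′) v →
      label m v ≡ label m′ v → αθFactor R m v ≡ αθFactor R m′ v
    αθFactor-cong {m} {m′} v matched labelled
      with isMatched (arcs m) v | label m v | isMatched (arcs m′) v | label m′ v | matched | labelled
    ... | true  | _     | _ | _ | refl | refl = refl
    ... | false | unlab | _ | _ | refl | refl = refl
    ... | false | labα  | _ | _ | refl | refl = refl
    ... | false | labαθ | _ | _ | refl | refl = refl

    unmatchedPart-cong : ∀ {m m′ : LMatching n} → endpoints (arcs m) ↭ endpoints (arcs m′) →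
      (∀ v → label m v ≡ label m′ v) → unmatchedPart m ≡ unmatchedPart m′
    unmatchedPart-cong {m} {m′} ends labels = cong₂ (λ xs ys → prodE xs ⊗ prodE ys)
      (map-cong (λ v → αFactor-cong {m} {m′} v (matched v) (labels v)) (allFin n))
      (map-cong (λ v → αθFactor-cong {m} {m′} v (matched v) (labels v)) (allFin n))
      where
      matched : ∀ v → isMatched (arcs m) v ≡ isMatched (arcs m′) v
      matched v = any-↭ _ ends

    unmatchedPart-↭ : ∀ m′ m {L′ L} → arcs m′ ↭ L′ → arcs m ↭ L → endpoints L′ ↭ endpoints L →
      (∀ v → label m′ v ≡ label m v) → unmatchedPart m′ ≡ unmatchedPart m
    unmatchedPart-↭ m′ m m′↭ m↭ ends =
      unmatchedPart-cong {m′} {m} (↭.trans (endpoints-↭ m′↭) (↭.trans ends (↭-sym (endpoints-↭ m↭))))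

open MatchedVertices

lemma4p1 : ∀ {c ℓ : Level} (R : CommutativeRing c ℓ) (n : ℕ) → 1 ≤ n →
    (m m₀ m₁ : LMatching n) (i j k l : Fin n) (rest : List (Arc n)) →
    i < j → j < k → k < l →
    arcs m ↭ (i , k) ∷ (j , l) ∷ rest →
    arcs m₀ ↭ (i , j) ∷ (k , l) ∷ rest →
    arcs m₁ ↭ (i , l) ∷ (j , k) ∷ rest →
    (∀ v → label m₀ v ≡ label m v) →
    (∀ v → label m₁ v ≡ label m v) →
    let open ExtAlg R n in
    F R m ⊕ F R m₀ ⊕ F R m₁ ≋ zeroE
lemma4p1 R n _ m m₀ m₁ i j k l rest _ _ _ m↭ m₀↭ m₁↭ labels₀ labels₁ = ≈ᵒ⇒≋ (begin
  F R m ⊕ F R m₀ ⊕ F R m₁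
    ≡⟨ ≡.cong₂ (λ X₀ X₁ → X ⊗ A ⊕ X₀ ⊗ A₀ ⊕ X₁ ⊗ A₁)
         (unmatchedPart-↭ R m₀ m m₀↭ m↭ (endpoints-resolution₀ i j k l rest) labels₀)
         (unmatchedPart-↭ R m₁ m m₁↭ m↭ (endpoints-resolution₁ i j k l rest) labels₁) ⟩
  X ⊗ A ⊕ X ⊗ A₀ ⊕ X ⊗ A₁
    ≈⟨ ⊕-cong (⊗-distribˡ-⊕ X A A₀) ≈ᵒ.refl ⟨
  X ⊗ (A ⊕ A₀) ⊕ X ⊗ A₁
    ≈⟨ ⊗-distribˡ-⊕ X (A ⊕ A₀) A₁ ⟨
  X ⊗ (A ⊕ A₀ ⊕ A₁)
    ≈⟨ ⊗-congˡ X (⊕-cong (⊕-cong (arcProduct-↭ m↭) (arcProduct-↭ m₀↭)) (arcProduct-↭ m₁↭)) ⟩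
  X ⊗ (arcProduct ((i , k) ∷ (j , l) ∷ rest) ⊕ arcProduct ((i , j) ∷ (k , l) ∷ rest)
                                             ⊕ arcProduct ((i , l) ∷ (j , k) ∷ rest))
    ≈⟨ ⊗-congˡ X (arcProduct-threeTerm i j k l rest) ⟩
  X ⊗ zeroE
    ≡⟨ ⊗-zeroʳ X ⟩
  zeroE ∎)
  where
  open ExtAlg R n
  open OddFunctionals R n
  open SetoidReasoning ≈ᵒ-setoid
  X  = unmatchedPart R m
  A  = arcProduct (arcs m)
  A₀ = arcProduct (arcs m₀)
  A₁ = arcProduct (arcs m₁)
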